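{- Let $T$ be a tree and let $G=B(T)$ be an extended nontrivial basic graph. If there are two leaves of $T$ with a common neighbor, then $B(T)$ has a star cutset.
   Context: For a tree $T$, view $T$ as bipartite with sides $V_1,V_2$; let $L$ be its set of leaves, $L_i=L\cap V_i$, and for $v\in L$ let $e(v)$ be the unique edge of $T$ at $v$. The graph $B(T)$ has vertex set $E(T)\cup\{x_1,x_2\}$ ($x_1,x_2$ new vertices), where two vertices are adjacent if they are two edges of $T$ sharing an end, or one is $x_i$ and the other is $e(v)$ with $v\in L_i$ ($i\in\{1,2\}$), or they are $x_1$ and $x_2$. A graph is an extended nontrivial basic graph if it equals $B(T)$ for a tree $T$ with at least three leaves and at least two non-leaves. A graph $G$ has a star cutset if $G$ is connected and there exist a vertex $v$ and $C\subseteq N[v]$ with $v\in C$ such that $G\setminus C$ is disconnected. -}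

module Defs where

open import Data.Nat using (ℕ; _<_; _≥_)
open import Data.Fin using (Fin; toℕ)
open import Data.Bool using (Bool; true; false; T)
open import Data.Product using (Σ; ∃; ∃-syntax; _×_; _,_; proj₁; proj₂)
open import Data.Sum using (_⊎_)
open import Data.List using (List; []; _∷_; _++_; [_]; length)
open import Data.List.Relation.Unary.Linked using (Linked)
open import Data.List.Relation.Unary.Unique.Propositional using (Unique)
open import Relation.Binary.PropositionalEquality using (_≡_; _≢_)
open import Relation.Nullary using (¬_)

data Walk {V : Set} (E : V → V → Set) (P : V → Set) : V → V → Set where
  here : ∀ {v} → P v → Walk E P v v
  step : ∀ {u w v} → P u → E u w → Walk E P w v → Walk E P u v

Connected : {V : Set} → (V → V → Set) → Set
Connected {V} E = (u v : V) → Walk E (λ _ → ⊤') u v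
  where
  open import Data.Unit using () renaming (⊤ to ⊤')

HasStarCutset : {V : Set} → (V → V → Set) → Set₁
HasStarCutset {V} E =
  Connected E ×
  Σ V λ v → Σ (V → Set) λ C →
    C v ×
    ((x : V) → C x → (x ≡ v ⊎ E v x)) ×
    Σ V λ a → Σ V λ b →
      ¬ C a × ¬ C b × ¬ Walk E (λ y → ¬ C y) a b

record SimpleGraph (n : ℕ) : Set where
  field
    adj     : Fin n → Fin n → Bool
    symm    : ∀ u v → adj u v ≡ adj v u
    irrefl  : ∀ v → adj v v ≡ false

module _ {n : ℕ} (G : SimpleGraph n) where
  open SimpleGraph G

  Adj : Fin n → Fin n → Set
  Adj u v = T (adj u v)

  HasCycle : Set
  HasCycle = Σ (Fin n) λ v₀ → Σ (List (Fin n)) λ rest →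
    length rest ≥ 2 × Unique (v₀ ∷ rest) × Linked Adj (v₀ ∷ rest ++ [ v₀ ])

  IsTree : Set
  IsTree = Connected Adj × ¬ HasCycle

  IsLeaf : Fin n → Set
  IsLeaf v = Σ (Fin n) λ u → Adj v u × (∀ w → Adj v w → w ≡ u)

  -- A bipartition (V₁ = side ⁻¹ true, V₂ = side ⁻¹ false).
  IsBipartition : (Fin n → Bool) → Set
  IsBipartition side = ∀ u v → Adj u v → side u ≢ side v

  Edge : Set
  Edge = Σ (Fin n × Fin n) λ p → toℕ (proj₁ p) < toℕ (proj₂ p) × Adj (proj₁ p) (proj₂ p)

  _∈ₑ_ : Fin n → Edge → Set
  v ∈ₑ ((a , b) , _) = v ≡ a ⊎ v ≡ b

  SameEdge : Edge → Edge → Set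
  SameEdge (p , _) (q , _) = p ≡ q

  -- Vertices of B(T): the edges of T plus the two new vertices
  -- x b (x true = x₁ for side V₁, x false = x₂ for side V₂).
  data BV : Set where
    edge : Edge → BV
    x    : Bool → BV

  -- For a leaf v with side v = i, e(v) is the unique edge containing v,
  -- so "e = e(v)" is "v ∈ e".
  module _ (side : Fin n → Bool) where
    LeafEdgeOf : Bool → Edge → Set
    LeafEdgeOf i e = Σ (Fin n) λ v → IsLeaf v × side v ≡ i × v ∈ₑ e

    BAdj : BV → BV → Set
    BAdj (edge e) (edge f) = ¬ SameEdge e f × Σ (Fin n) λ v → v ∈ₑ e × v ∈ₑ f
    BAdj (edge e) (x i)    = LeafEdgeOf i e
    BAdj (x i)    (edge e) = LeafEdgeOf i e
    BAdj (x i)    (x j)    = i ≢ j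

{-# OPTIONS --safe #-}
module Submission where

open import Defs
open import Data.Nat using (ℕ)
open import Data.Fin using (Fin; toℕ)
open import Data.Bool using (Bool; T; not)
open import Data.Product using (Σ; _×_; _,_; proj₁; proj₂)
open import Data.Sum using (_⊎_; inj₁; inj₂)
open import Data.Unit using (⊤; tt)
open import Data.Empty using (⊥-elim)
open import Function using (_∘_)
open import Relation.Binary using (Decidable; tri<; tri≈; tri>)
open import Relation.Binary.PropositionalEquality
  using (_≡_; _≢_; refl; sym; trans; subst; cong; cong₂)
open import Relation.Nullary using (¬_; yes; no)
import Data.Bool.Properties as Boolₚ
import Data.Fin.Properties as Finₚ
import Data.Nat.Properties as ℕₚ
import Data.Product.Properties as Productₚ

-- Let a, b be leaves of T with common neighbour w, and let e(a) = aw,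
-- e(b) = bw.  Every neighbour of e(b) in B(T) is an edge through w or the
-- vertex x_i of the common side i of a and b, and all of these are
-- neighbours of e(a).  So C = N[e(a)] ∖ {e(b)} isolates e(b), while
-- x_{not i} survives: it is not adjacent to e(a), whose ends are a (on
-- side i) and w (not a leaf).

module _ {V : Set} {E : V → V → Set} where

  _++ʷ_ : ∀ {P u v w} → Walk E P u v → Walk E P v w → Walk E P u w
  here _     ++ʷ q = q
  step p e r ++ʷ q = step p e (r ++ʷ q)

  walk-head : ∀ {P u v} → Walk E P u v → P u
  walk-head (here p)     = p
  walk-head (step p _ _) = p

  starCutset-of-dominated : Connected E → {u v z : V} → u ≢ v → z ≢ u →
    (∀ {y} → E u y → y ≢ u × (y ≡ v ⊎ E v y)) → ¬ (z ≡ v ⊎ E v z) →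
    HasStarCutset E
  starCutset-of-dominated conn {u} {v} {z} u≢v z≢u N[u]⊆C z∉N[v] =
    conn , v , C , (u≢v ∘ sym , inj₁ refl) , (λ _ → proj₂) ,
    u , z , (λ u∈C → proj₁ u∈C refl) , z∉N[v] ∘ proj₂ , u↛ z≢u
    where
    C : V → Set
    C y = y ≢ u × (y ≡ v ⊎ E v y)

    u↛ : ∀ {t} → t ≢ u → ¬ Walk E (λ y → ¬ C y) u t
    u↛ t≢u (here _)        = t≢u refl
    u↛ _   (step _ uy rest) = walk-head rest (N[u]⊆C uy)

module _ {n : ℕ} (G : SimpleGraph n) where
  open SimpleGraph G

  Adj-sym : ∀ {u v} → Adj G u v → Adj G v u
  Adj-sym {u} {v} = subst T (symm u v)

  Adj-irrefl : ∀ {v} → ¬ Adj G v v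
  Adj-irrefl {v} = subst T (irrefl v)

  edgeBetween : (u w : Fin n) → Adj G u w → Edge G
  edgeBetween u w uw with ℕₚ.<-cmp (toℕ u) (toℕ w)
  ... | tri< u<w _ _ = (u , w) , u<w , uw
  ... | tri≈ _ u≡w _ = ⊥-elim (Adj-irrefl (subst (Adj G u) (sym (Finₚ.toℕ-injective u≡w)) uw))
  ... | tri> _ _ w<u = (w , u) , w<u , Adj-sym uw

  edgeBetween-ends : ∀ u w (uw : Adj G u w) →
    proj₁ (edgeBetween u w uw) ≡ (u , w) ⊎ proj₁ (edgeBetween u w uw) ≡ (w , u)
  edgeBetween-ends u w uw with ℕₚ.<-cmp (toℕ u) (toℕ w)
  ... | tri< _ _ _ = inj₁ refl
  ... | tri≈ _ u≡w _ = ⊥-elim (Adj-irrefl (subst (Adj G u) (sym (Finₚ.toℕ-injective u≡w)) uw))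
  ... | tri> _ _ _ = inj₂ refl

  ∈ₑ-edgeBetweenˡ : ∀ u w (uw : Adj G u w) → _∈ₑ_ G u (edgeBetween u w uw)
  ∈ₑ-edgeBetweenˡ u w uw with edgeBetween u w uw | edgeBetween-ends u w uw
  ... | _ | inj₁ refl = inj₁ refl
  ... | _ | inj₂ refl = inj₂ refl

  ∈ₑ-edgeBetweenʳ : ∀ u w (uw : Adj G u w) → _∈ₑ_ G w (edgeBetween u w uw)
  ∈ₑ-edgeBetweenʳ u w uw with edgeBetween u w uw | edgeBetween-ends u w uw
  ... | _ | inj₁ refl = inj₂ refl
  ... | _ | inj₂ refl = inj₁ refl

  ∈ₑ-edgeBetween⁻ : ∀ {v} u w (uw : Adj G u w) →
    _∈ₑ_ G v (edgeBetween u w uw) → v ≡ u ⊎ v ≡ w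
  ∈ₑ-edgeBetween⁻ u w uw with edgeBetween u w uw | edgeBetween-ends u w uw
  ... | _ | inj₁ refl = λ { (inj₁ p) → inj₁ p ; (inj₂ p) → inj₂ p }
  ... | _ | inj₂ refl = λ { (inj₁ p) → inj₂ p ; (inj₂ p) → inj₁ p }

  SameEdge⇒≡ : ∀ {e f} → SameEdge G e f → e ≡ f
  SameEdge⇒≡ {p , p< , adj} {.p , p<′ , adj′} refl =
    cong (p ,_) (cong₂ _,_ (ℕₚ.<-irrelevant p< p<′) (Boolₚ.T-irrelevant adj adj′))

  sameEdge? : Decidable (SameEdge G)
  sameEdge? (p , _) (q , _) = Productₚ.≡-dec Finₚ._≟_ Finₚ._≟_ p q

  ∈ₑ-leaf⇒∈ₑ-neighbour : ∀ {v w} (f : Edge G) → IsLeaf G v → Adj G v w →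
    _∈ₑ_ G v f → _∈ₑ_ G w f
  ∈ₑ-leaf⇒∈ₑ-neighbour (_ , _ , pq) (_ , _ , uniq) vw (inj₁ refl) =
    inj₂ (trans (uniq _ vw) (sym (uniq _ pq)))
  ∈ₑ-leaf⇒∈ₑ-neighbour (_ , _ , pq) (_ , _ , uniq) vw (inj₂ refl) =
    inj₁ (trans (uniq _ vw) (sym (uniq _ (Adj-sym pq))))

  common-neighbour⇒¬IsLeaf : ∀ {a b w} → a ≢ b → Adj G a w → Adj G b w →
    ¬ IsLeaf G w
  common-neighbour⇒¬IsLeaf a≢b aw bw (_ , _ , uniq) =
    a≢b (trans (uniq _ (Adj-sym aw)) (sym (uniq _ (Adj-sym bw))))

  common-neighbour⇒same-side : ∀ {side a b w} → IsBipartition G side →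
    Adj G a w → Adj G b w → side a ≡ side b
  common-neighbour⇒same-side bip aw bw =
    trans (Boolₚ.¬-not (bip _ _ aw)) (sym (Boolₚ.¬-not (bip _ _ bw)))

  edgeVertex : Edge G → BV G
  edgeVertex = edge

  edgeVertex-injective : ∀ {e f} → edgeVertex e ≡ edgeVertex f → e ≡ f
  edgeVertex-injective refl = refl

  module _ (side : Fin n → Bool) where

    BWalk : BV G → BV G → Set
    BWalk = Walk (BAdj G side) (λ _ → ⊤)

    edges-sharing-vertex : ∀ {v} e f → _∈ₑ_ G v e → _∈ₑ_ G v f →
      edgeVertex f ≡ edgeVertex e ⊎ BAdj G side (edgeVertex e) (edgeVertex f)
    edges-sharing-vertex e f v∈e v∈f with sameEdge? e f
    ... | yes e~f = inj₁ (cong edgeVertex (sym (SameEdge⇒≡ e~f)))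
    ... | no e≁f  = inj₂ (e≁f , _ , v∈e , v∈f)

    edges-sharing-vertex-walk : ∀ {v} e f → _∈ₑ_ G v e → _∈ₑ_ G v f →
      BWalk (edgeVertex e) (edgeVertex f)
    edges-sharing-vertex-walk e f v∈e v∈f with edges-sharing-vertex e f v∈e v∈f
    ... | inj₁ f≡e = subst (BWalk (edgeVertex e)) (sym f≡e) (here tt)
    ... | inj₂ e~f = step tt e~f (here tt)

    lift-walk : ∀ {u y} (g f : Edge G) → _∈ₑ_ G u g → _∈ₑ_ G y f →
      Walk (Adj G) (λ _ → ⊤) u y → BWalk (edgeVertex g) (edgeVertex f)
    lift-walk g f u∈g u∈f (here _) = edges-sharing-vertex-walk g f u∈g u∈f
    lift-walk {u} g f u∈g y∈f (step {w = w} _ uw rest) =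
      edges-sharing-vertex-walk g uw-edge u∈g (∈ₑ-edgeBetweenˡ u w uw)
        ++ʷ lift-walk uw-edge f (∈ₑ-edgeBetweenʳ u w uw) y∈f rest
      where
      uw-edge : Edge G
      uw-edge = edgeBetween u w uw

    B-connected : ∀ {a} → Connected (Adj G) → IsLeaf G a → Connected (BAdj G side)
    B-connected {a} conn la@(w , aw , _) u v = toHub u ++ʷ fromHub v
      where
      hub : Edge G
      hub = edgeBetween a w aw
      a∈hub : _∈ₑ_ G a hub
      a∈hub = ∈ₑ-edgeBetweenˡ a w aw
      hub~x : BAdj G side (edgeVertex hub) (x (side a))
      hub~x = a , la , refl , a∈hub

      toHub : ∀ y → BWalk y (edgeVertex hub)
      toHub (edge g@((p , _) , _)) = lift-walk g hub (inj₁ refl) a∈hub (conn p a)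
      toHub (x j) with side a Boolₚ.≟ j
      ... | yes refl = step tt hub~x (here tt)
      ... | no  i≢j  = step tt (i≢j ∘ sym) (step tt hub~x (here tt))

      fromHub : ∀ y → BWalk (edgeVertex hub) y
      fromHub (edge g@((p , _) , _)) = lift-walk hub g a∈hub (inj₁ refl) (conn a p)
      fromHub (x j) with side a Boolₚ.≟ j
      ... | yes refl = step tt hub~x (here tt)
      ... | no  i≢j  = step tt hub~x (step tt i≢j (here tt))

    module _ {a b w : Fin n} (la : IsLeaf G a) (lb : IsLeaf G b) (a≢b : a ≢ b)
             (aw : Adj G a w) (bw : Adj G b w) where

      private
        ea eb : Edge G
        ea = edgeBetween a w aw
        eb = edgeBetween b w bw
        w-inner : ¬ IsLeaf G w
        w-inner = common-neighbour⇒¬IsLeaf a≢b aw bw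

      leafEdges-distinct : edgeVertex eb ≢ edgeVertex ea
      leafEdges-distinct eb≡ea with ∈ₑ-edgeBetween⁻ b w bw
          (subst (_∈ₑ_ G a) (sym (edgeVertex-injective eb≡ea)) (∈ₑ-edgeBetweenˡ a w aw))
      ... | inj₁ a≡b = a≢b a≡b
      ... | inj₂ refl = Adj-irrefl aw

      leafEdge-dominated : IsBipartition G side →
        ∀ {y} → BAdj G side (edgeVertex eb) y →
        y ≢ edgeVertex eb × (y ≡ edgeVertex ea ⊎ BAdj G side (edgeVertex ea) y)
      leafEdge-dominated _ {edge f} (eb≁f , v , v∈eb , v∈f) =
        eb≁f ∘ cong proj₁ ∘ sym ∘ edgeVertex-injective ,
        edges-sharing-vertex ea f (∈ₑ-edgeBetweenʳ a w aw) w∈f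
        where
        w∈f : _∈ₑ_ G w f
        w∈f with ∈ₑ-edgeBetween⁻ b w bw v∈eb
        ... | inj₁ refl = ∈ₑ-leaf⇒∈ₑ-neighbour f lb bw v∈f
        ... | inj₂ refl = v∈f
      leafEdge-dominated bip {x j} (v , lv , side-v , v∈eb) =
        (λ ()) , inj₂ (a , la , side-a , ∈ₑ-edgeBetweenˡ a w aw)
        where
        side-a : side a ≡ j
        side-a with ∈ₑ-edgeBetween⁻ b w bw v∈eb
        ... | inj₁ refl = trans (common-neighbour⇒same-side bip aw bw) side-v
        ... | inj₂ refl = ⊥-elim (w-inner lv)

      x-opposite∉N[leafEdge] :
        ¬ (x (not (side a)) ≡ edgeVertex ea ⊎ BAdj G side (edgeVertex ea) (x (not (side a))))
      x-opposite∉N[leafEdge] (inj₁ ())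
      x-opposite∉N[leafEdge] (inj₂ (v , lv , side-v , v∈ea))
        with ∈ₑ-edgeBetween⁻ a w aw v∈ea
      ... | inj₁ refl = Boolₚ.not-¬ refl side-v
      ... | inj₂ refl = w-inner lv

lemma2p2 : (n : ℕ) (G : SimpleGraph n) (side : Fin n → Bool) →
    IsTree G → IsBipartition G side →
    -- at least three leaves
    (Σ (Fin n) λ a → Σ (Fin n) λ b → Σ (Fin n) λ c →
      IsLeaf G a × IsLeaf G b × IsLeaf G c × a ≢ b × a ≢ c × b ≢ c) →
    -- at least two non-leaves
    (Σ (Fin n) λ a → Σ (Fin n) λ b → ¬ IsLeaf G a × ¬ IsLeaf G b × a ≢ b) →
    -- two leaves with a common neighbour
    (Σ (Fin n) λ a → Σ (Fin n) λ b → Σ (Fin n) λ w →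
      IsLeaf G a × IsLeaf G b × a ≢ b × Adj G a w × Adj G b w) →
    HasStarCutset (BAdj G side)
lemma2p2 n G side (conn , _) bip _ _ (a , b , w , la , lb , a≢b , aw , bw) =
  starCutset-of-dominated (B-connected G side conn la)
    (leafEdges-distinct G side la lb a≢b aw bw) (λ ())
    (leafEdge-dominated G side la lb a≢b aw bw bip)
    (x-opposite∉N[leafEdge] G side la lb a≢b aw bw)
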